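{- Let $a_0=\begin{pmatrix}0&0&-1\\1&0&-1\\0&1&-1\end{pmatrix}$ and let $S_{\mathbb Z_4\times\mathbb Z_3}\subset \mathrm{Mat}_3^{\otimes 3}$ be the set of the following $23$ rank one tensors: (a) the $11$ cubes $m\otimes m\otimes m$ for $m$ in the list $-a_0$, $\begin{pmatrix}0&1&0\\0&1&0\\0&0&0\end{pmatrix}$, $\begin{pmatrix}0&0&0\\-1&0&1\\-1&0&1\end{pmatrix}$, $\begin{pmatrix}1&0&0\\0&0&0\\0&0&0\end{pmatrix}$, $\begin{pmatrix}0&0&0\\-1&1&0\\0&0&0\end{pmatrix}$, $\begin{pmatrix}0&0&0\\0&0&0\\0&-1&1\end{pmatrix}$, $\begin{pmatrix}0&0&1\\0&0&1\\0&0&1\end{pmatrix}$, $\begin{pmatrix}0&-1&0\\1&-1&0\\0&0&0\end{pmatrix}$, $\begin{pmatrix}0&0&0\\1&0&-1\\0&1&-1\end{pmatrix}$, $\begin{pmatrix}0&0&-1\\0&0&-1\\0&1&-1\end{pmatrix}$, $\begin{pmatrix}0&0&-1\\1&0&-1\\1&0&-1\end{pmatrix}$; (b) for each of the four triples $(p,q,r)$ below, the three tensors $p\otimes q\otimes r$, $q\otimes r\otimes p$, $r\otimes p\otimes q$: $\left(\begin{pmatrix}0&0&0\\0&0&1\\0&0&0\end{pmatrix},\begin{pmatrix}0&0&0\\0&0&0\\-1&1&0\end{pmatrix},\begin{pmatrix}0&0&0\\0&1&-1\\0&1&-1\end{pmatrix}\right)$, $\left(\begin{pmatrix}0&0&0\\0&0&0\\-1&0&0\end{pmatrix},\begin{pmatrix}0&1&-1\\0&1&-1\\0&1&-1\end{pmatrix},\begin{pmatrix}0&0&-1\\0&0&-1\\0&0&0\end{pmatrix}\right)$,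 $\left(\begin{pmatrix}-1&1&0\\-1&1&0\\-1&1&0\end{pmatrix},\begin{pmatrix}0&0&-1\\0&0&0\\0&0&0\end{pmatrix},\begin{pmatrix}0&0&0\\1&0&0\\1&0&0\end{pmatrix}\right)$, $\left(\begin{pmatrix}0&1&-1\\0&0&0\\0&0&0\end{pmatrix},\begin{pmatrix}0&0&0\\1&0&0\\0&0&0\end{pmatrix},\begin{pmatrix}1&-1&0\\1&-1&0\\0&0&0\end{pmatrix}\right)$. Then the sum of the $23$ tensors in $S_{\mathbb Z_4\times\mathbb Z_3}$ equals the matrix multiplication tensor $M_{\langle 3\rangle}$; that is, $S_{\mathbb Z_4\times\mathbb Z_3}$ is a rank $23$ decomposition of $M_{\langle 3\rangle}$, and it is invariant under the cyclic permutation $x\otimes y\otimes z\mapsto y\otimes z\otimes x$.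
   Context: $\mathrm{Mat}_3$ is the space of complex $3\times 3$ matrices. An element $x\otimes y\otimes z\in\mathrm{Mat}_3^{\otimes 3}$ is identified with the trilinear form $(X,Y,Z)\mapsto(\sum_{i,j}x_{ij}X_{ij})(\sum_{i,j}y_{ij}Y_{ij})(\sum_{i,j}z_{ij}Z_{ij})$ on $\mathrm{Mat}_3$, extended linearly. The matrix multiplication tensor $M_{\langle 3\rangle}\in\mathrm{Mat}_3^{\otimes 3}$ is the tensor corresponding to the trilinear form $(X,Y,Z)\mapsto\operatorname{trace}(XYZ)$; equivalently $M_{\langle 3\rangle}=\sum_{i,j,k=1}^3E_{ij}\otimes E_{jk}\otimes E_{ki}$, where $E_{ij}$ are the matrix units. A rank decomposition of size $r$ is an expression of $M_{\langle 3\rangle}$ as a sum of $r$ tensors of the form $x\otimes y\otimes z$. -}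

module Defs where

open import Data.Integer using (ℤ; +_; -[1+_]; _+_; _*_)
open import Data.Fin using (Fin; _≟_)
open import Data.Vec using (Vec; []; _∷_; lookup; tabulate)
open import Data.List using (List; []; _∷_; _++_; foldr; map; concatMap; allFin)
open import Data.Product using (_×_; _,_)
open import Relation.Nullary.Decidable using (does)
open import Data.Bool using (if_then_else_)
open import Relation.Binary.PropositionalEquality using (_≡_)

-- 3×3 integer matrices, stored as a vector of rows: M_ij = lookup (lookup M i) j.
-- (All entries in the statement are integers; ℤ ⊂ ℂ.)
Mat : Set
Mat = Vec (Vec ℤ 3) 3

entry : Mat → Fin 3 → Fin 3 → ℤ
entry M i j = lookup (lookup M i) j

-- A tensor in Mat₃ ⊗ Mat₃ ⊗ Mat₃, given by its coefficients with respect to the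
-- basis E_ij ⊗ E_kl ⊗ E_mn.
Tensor : Set
Tensor = Fin 3 → Fin 3 → Fin 3 → Fin 3 → Fin 3 → Fin 3 → ℤ

_≈T_ : Tensor → Tensor → Set
T ≈T U = ∀ i j k l m n → T i j k l m n ≡ U i j k l m n

zeroT : Tensor
zeroT _ _ _ _ _ _ = + 0

_+T_ : Tensor → Tensor → Tensor
(T +T U) i j k l m n = T i j k l m n + U i j k l m n

_⊗_⊗_ : Mat → Mat → Mat → Tensor
(x ⊗ y ⊗ z) i j k l m n = entry x i j * entry y k l * entry z m n

Triple : Set
Triple = Mat × Mat × Mat

toTensor : Triple → Tensor
toTensor (x , y , z) = x ⊗ y ⊗ z

sumT : List Triple → Tensor
sumT ts = foldr (λ t acc → toTensor t +T acc) zeroT ts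

cyc : Triple → Triple
cyc (x , y , z) = (y , z , x)

E : Fin 3 → Fin 3 → Mat
E i j = tabulate λ a → tabulate λ b →
  if does (a ≟ i) then (if does (b ≟ j) then + 1 else + 0) else + 0

M3terms : List Triple
M3terms = concatMap (λ i → concatMap (λ j → map (λ k → (E i j , E j k , E k i)) (allFin 3)) (allFin 3)) (allFin 3)

M3 : Tensor
M3 = sumT M3terms

private
  o p m : ℤ
  o = + 0
  p = + 1
  m = -[1+ 0 ]

mat : ℤ → ℤ → ℤ → ℤ → ℤ → ℤ → ℤ → ℤ → ℤ → Mat
mat a b c d e f g h i = (a ∷ b ∷ c ∷ []) ∷ (d ∷ e ∷ f ∷ []) ∷ (g ∷ h ∷ i ∷ []) ∷ []

a₀ : Mat
a₀ = mat o o m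
         p o m
         o p m

cube : Mat → Triple
cube x = (x , x , x)

rots : Mat → Mat → Mat → List Triple
rots x y z = (x , y , z) ∷ (y , z , x) ∷ (z , x , y) ∷ []

cubeMats : List Mat
cubeMats =
  mat o o p  m o p  o m p ∷
  mat o p o  o p o  o o o ∷
  mat o o o  m o p  m o p ∷
  mat p o o  o o o  o o o ∷
  mat o o o  m p o  o o o ∷
  mat o o o  o o o  o m p ∷
  mat o o p  o o p  o o p ∷
  mat o m o  p m o  o o o ∷
  mat o o o  p o m  o p m ∷
  mat o o m  o o m  o p m ∷
  mat o o m  p o m  p o m ∷ []

S-Z4×Z3 : List Triple
S-Z4×Z3 =
  map cube cubeMats ++
  (rots (mat o o o  o o p  o o o) (mat o o o  o o o  m p o) (mat o o o  o p m  o p m) ++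
   rots (mat o o o  o o o  m o o) (mat o p m  o p m  o p m) (mat o o m  o o m  o o o) ++
   rots (mat m p o  m p o  m p o) (mat o o m  o o o  o o o) (mat o o o  p o o  p o o) ++
   rots (mat o p m  o o o  o o o) (mat o o o  p o o  o o o) (mat p m o  p m o  o o o))

-- The three claims are of different nature and are proved separately.
--  * The size 23 is immediate: the list has 11 cubes and 4 orbits of size 3.
--  * Invariance is structural: a cube x ⊗ x ⊗ x is fixed by the cyclic shift,
--    the three rotations of a triple form an orbit of the shift, and lists
--    closed under the shift are closed under concatenation.  Since the list
--    is a concatenation of cubes and rotation orbits, it is closed.
--  * The identity Σ S = M⟨3⟩ is a finite identity between integer tensors with
--    3⁶ = 729 coefficients.  Equality of tensors is decidable (coefficientwise,
--    over finitely many indices), so the identity is obtained by evaluating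
--    that decision procedure: a proof by computation.
module Submission where

open import Defs
open import Data.Product using (_×_; _,_)
open import Data.Sum using (inj₁; inj₂)
open import Data.List using (List; length; map; _++_)
open import Data.List.Membership.Propositional using (_∈_)
open import Data.List.Membership.Propositional.Properties
  using (∈-++⁻; ∈-++⁺ˡ; ∈-++⁺ʳ; ∈-map⁻)
open import Data.List.Relation.Unary.Any using (here; there)
open import Data.Fin.Properties using (all?)
open import Data.Integer.Properties using () renaming (_≟_ to _≟ℤ_)
open import Relation.Nullary using (Dec)
open import Relation.Nullary.Decidable using (toWitness)
open import Relation.Binary.PropositionalEquality using (_≡_; refl; subst)

_≈T?_ : (T U : Tensor) → Dec (T ≈T U)
T ≈T? U =
  all? λ i → all? λ j → all? λ k → all? λ l → all? λ m → all? λ n →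
    T i j k l m n ≟ℤ U i j k l m n

CycClosed : List Triple → Set
CycClosed ts = ∀ t → t ∈ ts → cyc t ∈ ts

cyc-cube : ∀ x → cyc (cube x) ≡ cube x
cyc-cube x = refl

cubes-closed : ∀ xs → CycClosed (map cube xs)
cubes-closed xs t t∈cubes with ∈-map⁻ cube t∈cubes
... | x , _ , refl = subst (_∈ map cube xs) (cyc-cube x) t∈cubes

rots-closed : ∀ x y z → CycClosed (rots x y z)
rots-closed x y z _ (here refl)                 = there (here refl)
rots-closed x y z _ (there (here refl))         = there (there (here refl))
rots-closed x y z _ (there (there (here refl))) = here refl

++-closed : ∀ {ts us} → CycClosed ts → CycClosed us → CycClosed (ts ++ us)
++-closed {ts} ts-closed us-closed t t∈ts++us with ∈-++⁻ ts t∈ts++us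
... | inj₁ t∈ts = ∈-++⁺ˡ (ts-closed t t∈ts)
... | inj₂ t∈us = ∈-++⁺ʳ ts (us-closed t t∈us)

S-cycClosed : CycClosed S-Z4×Z3
S-cycClosed =
  ++-closed (cubes-closed cubeMats)
    (++-closed (rots-closed _ _ _)
      (++-closed (rots-closed _ _ _)
        (++-closed (rots-closed _ _ _) (rots-closed _ _ _))))

S-decomposes-M3 : sumT S-Z4×Z3 ≈T M3
S-decomposes-M3 = toWitness {a? = sumT S-Z4×Z3 ≈T? M3} _

mainTheorem1 : (length S-Z4×Z3 ≡ 23)
    × (sumT S-Z4×Z3 ≈T M3)
    × (∀ t → t ∈ S-Z4×Z3 → cyc t ∈ S-Z4×Z3)
mainTheorem1 = refl , S-decomposes-M3 , S-cycClosed
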